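{- For any finite word $w$, $\left|\bigcup_{z\in\mathrm{Lyn}(w)}\mathrm{CS}_w(z)\right|\le|w|$.
   Context: Fix a total order on letters and the induced lexicographic order. $F(w)$ is the set of factors of $w$ (including the empty word), $F_w(\ell)$ those of length $\ell$. For non-empty $z$, $[z]=\{z[i..|z|]z[1..i-1]:1\le i\le|z|\}$; for non-empty $x$ and $m\ge0$, $x^{m/|x|}$ is the length-$m$ prefix of $xxx\cdots$, and $[z]_m=\{x^{m/|x|}:x\in[z]\}$. A Lyndon word is a primitive word that is lexicographically smallest in its conjugacy class; $\mathrm{Lyn}(w)$ is the set of Lyndon factors of $w$. The Rauzy graph $\Gamma_w(\ell)$ is the directed multigraph with vertex set $F_w(\ell)$ and arc set $F_w(\ell+1)$, arc $u$ going from $u[1..\ell]$ to $u[2..\ell+1]$; $\Gamma_w$ is the disjoint union of $\Gamma_w(\ell)$ for $0\le\ell\le|w|$. For $z\in\mathrm{Lyn}(w)$, $\mathrm{CS}_w(z)$ is the set of circuits of $\Gamma_w$ whose arc set equals $[z]_m$ for some integer $m\ge|z|$ (one circuit for each such $m$ with $[z]_m\subseteq F(w)$; cyclic rotations are not distinguished). -}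

module Defs where

open import Data.Nat using (ℕ; suc; _≤_; _<_)
open import Data.List using (List; []; _∷_; _++_; length; take; drop; concat; replicate)
open import Data.List.Membership.Propositional using (_∈_)
open import Data.List.Relation.Unary.All using (All)
open import Data.List.Relation.Unary.Linked using (Linked)
open import Data.List.Relation.Unary.Unique.Propositional using (Unique)
open import Data.List.Relation.Binary.Lex.Core using (Lex-≤)
open import Data.Product using (Σ; ∃; _×_; _,_)
open import Relation.Binary.PropositionalEquality using (_≡_)
open import Relation.Nullary using (¬_)
open import Data.Empty using (⊥)
open import Function.Bundles using (_⇔_)

Word : Set → Set
Word A = List A

module _ {A : Set} where

  Factor : Word A → Word A → Set
  Factor u w = ∃ λ p → ∃ λ s → p ++ u ++ s ≡ w

  -- rotation z[i+1..|z|] z[1..i]  (the conjugates [z] are rot i z for i < |z|)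
  rot : ℕ → Word A → Word A
  rot i z = drop i z ++ take i z

  -- x^{m/|x|}: length-m prefix of x x x ...   (for non-empty x)
  powPrefix : Word A → ℕ → Word A
  powPrefix x m = take m (concat (replicate m x))

  InZm : Word A → ℕ → Word A → Set
  InZm z m u = Σ ℕ λ i → i < length z × u ≡ powPrefix (rot i z) m

  Primitive : Word A → Set
  Primitive z = ¬ (z ≡ []) × ¬ (∃ λ u → ∃ λ k → 2 ≤ k × z ≡ concat (replicate k u))

  Lyndon : (_<_ : A → A → Set) → Word A → Set
  Lyndon _<ₐ_ z = Primitive z ×
    (∀ i → i < length z → Lex-≤ _≡_ _<ₐ_ z (rot i z))

  -- adjacency of arcs in the Rauzy graph Γ_w(ℓ): head of a = tail of b
  Adj : ℕ → Word A → Word A → Set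
  Adj ℓ a b = drop 1 a ≡ take ℓ b

  ClosedWalk : ℕ → List (Word A) → Set
  ClosedWalk ℓ [] = ⊥
  ClosedWalk ℓ (a ∷ as) = Linked (Adj ℓ) ((a ∷ as) ++ (a ∷ []))

  -- A circuit is represented by its cyclic list of arcs (taken up to rotation,
  -- see SameCircuit).
  IsCircuit : Word A → List (Word A) → Set
  IsCircuit w c = Σ ℕ λ ℓ → ℓ ≤ length w ×
    All (λ a → length a ≡ suc ℓ × Factor a w) c ×
    ClosedWalk ℓ c × Unique c

  SameCircuit : List (Word A) → List (Word A) → Set
  SameCircuit c c' = Σ ℕ λ i → c' ≡ drop i c ++ take i c

  InCS : Word A → Word A → List (Word A) → Set
  InCS w z c = IsCircuit w c ×
    (Σ ℕ λ m → length z ≤ m × (∀ u → (u ∈ c) ⇔ InZm z m u))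

  InUnionCS : (_<_ : A → A → Set) → Word A → List (Word A) → Set
  InUnionCS _<ₐ_ w c = ∃ λ z → (Factor z w × Lyndon _<ₐ_ z) × InCS w z c

-- Every circuit of CS_w(z) contains the arc z^{m/|z|}, its representative. A Lyndon word is
-- unbordered, so a Lyndon word z′ with |z| ≤ |z′| ≤ m and z′^{m/|z′|} ∈ [z]_m equals z; and the arcs
-- of [z]_m are determined by their source vertex, so a circuit is determined by any one of its arcs.
-- Hence distinct circuits have distinct representatives.
-- Deleting all representatives from Γ_w keeps it connected component by component: a deleted arc
-- is bypassed by the rest of its circuit, whose deleted arcs represent circuits with strictly
-- shorter Lyndon roots. Γ_w has one component per level 0 ≤ ℓ ≤ |w|, #F(w) vertices and #F(w) − 1
-- arcs, so at most (#F(w) − 1) − #F(w) + (|w| + 1) = |w| arcs can be deleted without disconnecting it.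

module Submission where

open import Data.Empty using (⊥; ⊥-elim)
open import Data.List
  using (List; []; _∷_; _++_; [_]; length; take; drop; map; concat; concatMap; replicate; filter; inits; tails;
         deduplicate)
open import Data.List.Properties
  using (length-++; length-++-sucʳ; length-++-≤ˡ; length-++-≤ʳ; length-map; length-take; length-drop;
         ++-assoc; ++-identityʳ; ++-cancelˡ; ∷-injective; take-take; take++drop≡id; ≡-dec)
open import Data.List.Membership.Propositional using (_∈_; _∉_)
open import Data.List.Membership.Propositional.Properties
  using (∈-∃++; ∈-++⁺ˡ; ∈-++⁺ʳ; ∈-++⁻; ∈-map⁺; ∈-map⁻; ∈-filter⁺; ∈-deduplicate⁺; ∈-deduplicate⁻)
open import Data.List.Relation.Binary.Lex.Core using (Lex-≤; base; this; next)
open import Data.List.Relation.Binary.Lex.Strict using (≤-antisymmetric)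
open import Data.List.Relation.Binary.Permutation.Propositional
  using (_↭_; ↭-sym; ↭-trans; ↭-reflexive; ↭⇒↭ₛ)
open import Data.List.Relation.Binary.Permutation.Propositional.Properties
  using (++-comm; drop-∷; ↭-singleton-inv; All-resp-↭; ∈-resp-↭)
import Data.List.Relation.Binary.Permutation.Setoid.Properties as PermS
open import Data.List.Relation.Binary.Pointwise using (Pointwise-≡⇒≡)
open import Data.List.Relation.Binary.Subset.Propositional using (_⊆_)
open import Data.List.Relation.Unary.All as All using (All; []; _∷_)
open import Data.List.Relation.Unary.AllPairs as AllPairs using (AllPairs; []; _∷_)
import Data.List.Relation.Unary.AllPairs.Properties as AllPairsₚ
open import Data.List.Relation.Unary.Any using (here; there)
open import Data.List.Relation.Unary.Linked using (Linked; []; [-]; _∷_)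
open import Data.List.Relation.Unary.Unique.Propositional using (Unique)
open import Data.List.Relation.Unary.Unique.Propositional.Properties using (Unique[x∷xs]⇒x∉xs)
open import Data.List.Relation.Unary.Unique.DecPropositional.Properties using (deduplicate-!)
open import Data.Nat using (ℕ; zero; suc; _+_; _*_; _∸_; _⊓_; _≤_; _<_; z≤n; s≤s)
open import Data.Nat.Properties
open import Data.Product using (∃; ∃₂; _×_; _,_; proj₁; proj₂; map₁; map₂)
open import Data.Sum using (_⊎_; inj₁; inj₂)
open import Relation.Binary.PropositionalEquality
  using (_≡_; _≢_; refl; setoid; sym; trans; cong; cong₂; subst; subst₂; module ≡-Reasoning)
open import Relation.Binary.Structures using (IsStrictPartialOrder; IsStrictTotalOrder)
open import Relation.Binary.Definitions using (DecidableEquality)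
open import Function.Bundles using (_⇔_; Equivalence)
open import Relation.Nullary using (¬_; yes; no; ¬?)
open import Relation.Nullary.Decidable using (decidable-stable; _×-dec_)
open import Relation.Nullary.Decidable.Core using (¬¬-excluded-middle)
open import Relation.Unary using (Decidable)
open import Relation.Unary.Properties using (∁?)
open import Defs

module _ {A : Set} where

  take-length-++ : ∀ (xs ys : List A) → take (length xs) (xs ++ ys) ≡ xs
  take-length-++ []       ys = refl
  take-length-++ (x ∷ xs) ys = cong (x ∷_) (take-length-++ xs ys)

  drop-length-++ : ∀ (xs ys : List A) → drop (length xs) (xs ++ ys) ≡ ys
  drop-length-++ []       ys = refl
  drop-length-++ (x ∷ xs) ys = drop-length-++ xs ys

  take-length+-++ : ∀ (xs ys : List A) k → take (length xs + k) (xs ++ ys) ≡ xs ++ take k ys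
  take-length+-++ []       ys k = refl
  take-length+-++ (x ∷ xs) ys k = cong (x ∷_) (take-length+-++ xs ys k)

  take-++-≤ : ∀ {k} (xs ys : List A) → k ≤ length xs → take k (xs ++ ys) ≡ take k xs
  take-++-≤ {zero}  xs       ys _         = refl
  take-++-≤ {suc k} (x ∷ xs) ys (s≤s k≤) = cong (x ∷_) (take-++-≤ xs ys k≤)

  take-take-≤ : ∀ {k n} (xs : List A) → k ≤ n → take k (take n xs) ≡ take k xs
  take-take-≤ {k} {n} xs k≤n = trans (take-take k n xs) (cong (λ j → take j xs) (m≤n⇒m⊓n≡m k≤n))

  take-++-take : ∀ {n k} (xs ys : List A) → n ≤ k → take n (xs ++ take k ys) ≡ take n (xs ++ ys)
  take-++-take {zero}  xs       ys _   = refl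
  take-++-take {suc n} []       ys n≤k = take-take-≤ ys n≤k
  take-++-take {suc n} (x ∷ xs) ys n≤k = cong (x ∷_) (take-++-take xs ys (≤-trans (n≤1+n n) n≤k))

  length-take-≤ : ∀ {k} (xs : List A) → k ≤ length xs → length (take k xs) ≡ k
  length-take-≤ {k} xs k≤ = trans (length-take k xs) (m≤n⇒m⊓n≡m k≤)

  take-suc-≢[] : ∀ {k} {xs : List A} → xs ≢ [] → take (suc k) xs ≢ []
  take-suc-≢[] {xs = []}    xs≢[] = ⊥-elim (xs≢[] refl)
  take-suc-≢[] {xs = _ ∷ _} _     ()

  ≢[]⇒0<length : ∀ {xs : List A} → xs ≢ [] → 0 < length xs
  ≢[]⇒0<length {[]}    xs≢[] = ⊥-elim (xs≢[] refl)
  ≢[]⇒0<length {_ ∷ _} _     = s≤s z≤n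

  ∈-remove : ∀ {v y : A} ys₁ ys₂ → v ∈ ys₁ ++ y ∷ ys₂ → v ≢ y → v ∈ ys₁ ++ ys₂
  ∈-remove []        ys₂ (here v≡y)  v≢y = ⊥-elim (v≢y v≡y)
  ∈-remove []        ys₂ (there v∈)  _   = v∈
  ∈-remove (_ ∷ ys₁) ys₂ (here v≡y)  _   = here v≡y
  ∈-remove (_ ∷ ys₁) ys₂ (there v∈)  v≢y = there (∈-remove ys₁ ys₂ v∈ v≢y)

  Unique-⊆⇒length≤ : ∀ {xs ys : List A} → Unique xs → xs ⊆ ys → length xs ≤ length ys
  Unique-⊆⇒length≤ {[]}     _             _     = z≤n
  Unique-⊆⇒length≤ {x ∷ xs} (x∉xs ∷ !xs) xs⊆ys with ∈-∃++ (xs⊆ys (here refl))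
  ... | ys₁ , ys₂ , refl =
    ≤-trans (s≤s (Unique-⊆⇒length≤ !xs xs⊆ys₁ys₂)) (≤-reflexive (sym (length-++-sucʳ ys₁ x ys₂)))
    where
    xs⊆ys₁ys₂ : xs ⊆ ys₁ ++ ys₂
    xs⊆ys₁ys₂ v∈xs = ∈-remove ys₁ ys₂ (xs⊆ys (there v∈xs)) (λ v≡x → All.lookup x∉xs v∈xs (sym v≡x))

  length-filter+length-filter-∁ : ∀ {P : A → Set} (P? : Decidable P) xs →
    length (filter P? xs) + length (filter (∁? P?) xs) ≡ length xs
  length-filter+length-filter-∁ P? []       = refl
  length-filter+length-filter-∁ P? (x ∷ xs) with P? x
  ... | yes _ = cong suc (length-filter+length-filter-∁ P? xs)
  ... | no  _ = trans (+-suc _ _) (cong suc (length-filter+length-filter-∁ P? xs))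

  length-inits : ∀ (xs : List A) → length (inits xs) ≡ suc (length xs)
  length-inits []       = refl
  length-inits (x ∷ xs) = cong suc (trans (length-map (x ∷_) (inits xs)) (length-inits xs))

-- Periodic words and rotations

module _ {A : Set} where

  open ≡-Reasoning

  pow : Word A → ℕ → Word A
  pow t a = concat (replicate a t)

  pow-+ : ∀ t a b → pow t (a + b) ≡ pow t a ++ pow t b
  pow-+ t zero    b = refl
  pow-+ t (suc a) b = trans (cong (t ++_) (pow-+ t a b)) (sym (++-assoc t (pow t a) (pow t b)))

  pow-suc : ∀ t a → pow t (suc a) ≡ pow t a ++ t
  pow-suc t a = trans (cong (pow t) (+-comm 1 a)) (trans (pow-+ t a 1) (cong (pow t a ++_) (++-identityʳ t)))

  ≤-length-pow : ∀ {t} m → t ≢ [] → m ≤ length (pow t m)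
  ≤-length-pow {[]}    m t≢[] = ⊥-elim (t≢[] refl)
  ≤-length-pow {x ∷ t} m _    = subst (m ≤_) (sym (length-pow m)) (m≤m*n m (length (x ∷ t)))
    where
    length-pow : ∀ a → length (pow (x ∷ t) a) ≡ a * length (x ∷ t)
    length-pow zero    = refl
    length-pow (suc a) = trans (length-++ (x ∷ t)) (cong (length (x ∷ t) +_) (length-pow a))

  rot-zero : ∀ (z : Word A) → rot 0 z ≡ z
  rot-zero = ++-identityʳ

  rot-++ : ∀ (u v : Word A) → rot (length u) (u ++ v) ≡ v ++ u
  rot-++ u v = cong₂ _++_ (drop-length-++ u v) (take-length-++ u v)

  length-rot : ∀ i (z : Word A) → length (rot i z) ≡ length z
  length-rot i z = begin
    length (drop i z ++ take i z)                ≡⟨ length-++ (drop i z) ⟩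
    length (drop i z) + length (take i z)        ≡⟨ cong₂ _+_ (length-drop i z) (length-take i z) ⟩
    (length z ∸ i) + (i ⊓ length z)              ≡⟨ +-comm (length z ∸ i) _ ⟩
    (i ⊓ length z) + (length z ∸ i)              ≡⟨ m⊓n+n∸m≡n i (length z) ⟩
    length z                                     ∎

  rot-rot : ∀ i (z : Word A) → rot (length z ∸ i) (rot i z) ≡ z
  rot-rot i z = begin
    rot (length z ∸ i) (drop i z ++ take i z)        ≡⟨ cong (λ j → rot j (rot i z)) (length-drop i z) ⟨
    rot (length (drop i z)) (drop i z ++ take i z)   ≡⟨ rot-++ (drop i z) (take i z) ⟩
    take i z ++ drop i z                             ≡⟨ take++drop≡id i z ⟩
    z                                                ∎

  rot-≢[] : ∀ i {z : Word A} → z ≢ [] → rot i z ≢ []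
  rot-≢[] i {z} z≢[] rot≡[] =
    <-irrefl (cong length (sym rot≡[])) (subst (0 <_) (sym (length-rot i z)) (≢[]⇒0<length z≢[]))

  rot-↭ : ∀ i (z : Word A) → rot i z ↭ z
  rot-↭ i z = ↭-trans (++-comm (drop i z) (take i z)) (↭-reflexive (take++drop≡id i z))

  powPrefix-unfold : ∀ {x : Word A} m → x ≢ [] → powPrefix x m ≡ take m (x ++ powPrefix x m)
  powPrefix-unfold {x} m x≢[] = begin
    take m (pow x m)                  ≡⟨ take-++-≤ (pow x m) x (≤-length-pow m x≢[]) ⟨
    take m (pow x m ++ x)             ≡⟨ cong (take m) (pow-suc x m) ⟨
    take m (x ++ pow x m)             ≡⟨ take-++-take x (pow x m) ≤-refl ⟨
    take m (x ++ take m (pow x m))    ∎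

  take-powPrefix : ∀ {m} (x : Word A) → length x ≤ m → take (length x) (powPrefix x m) ≡ x
  take-powPrefix         []          _     = refl
  take-powPrefix {m} x@(_ ∷ _) |x|≤m = begin
    take (length x) (powPrefix x m)                      ≡⟨ cong (take (length x)) (powPrefix-unfold m (λ ())) ⟩
    take (length x) (take m (x ++ powPrefix x m))        ≡⟨ take-take-≤ (x ++ powPrefix x m) |x|≤m ⟩
    take (length x) (x ++ powPrefix x m)                 ≡⟨ take-length-++ x (powPrefix x m) ⟩
    x                                                    ∎

  length-powPrefix : ∀ {x : Word A} m → x ≢ [] → length (powPrefix x m) ≡ m
  length-powPrefix {x} m x≢[] = length-take-≤ (pow x m) (≤-length-pow m x≢[])

  powPrefix∈[z] : ∀ {z : Word A} {m} → z ≢ [] → InZm z m (powPrefix z m)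
  powPrefix∈[z] {z} {m} z≢[] = 0 , ≢[]⇒0<length z≢[] , cong (λ x → powPrefix x m) (sym (rot-zero z))

  powPrefix-length : ∀ (x : Word A) → powPrefix x (length x) ≡ x
  powPrefix-length []          = refl
  powPrefix-length x@(_ ∷ _) = take-length-++ x (pow x (length x ∸ 1))

  take-powPrefix-period : ∀ {y : Word A} {q m} → y ≢ [] → length y ≤ q → q ≤ m →
    let x = take q (powPrefix y m) in x ≡ y ++ take (q ∸ length y) x
  take-powPrefix-period {y} {q} {m} y≢[] |y|≤q q≤m = begin
    take q P                                  ≡⟨ cong (take q) (powPrefix-unfold m y≢[]) ⟩
    take q (take m (y ++ P))                  ≡⟨ take-take-≤ (y ++ P) q≤m ⟩
    take q (y ++ P)                           ≡⟨ cong (λ j → take j (y ++ P)) (m+[n∸m]≡n |y|≤q) ⟨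
    take (length y + k) (y ++ P)              ≡⟨ take-length+-++ y P k ⟩
    y ++ take k P                             ≡⟨ cong (y ++_) (take-take-≤ P (m∸n≤m q (length y))) ⟨
    y ++ take k (take q P)                    ∎
    where
    P : Word A
    P = powPrefix y m

    k : ℕ
    k = q ∸ length y

  ++-prefix : ∀ (xs ys xs′ ys′ : List A) → xs ++ ys ≡ xs′ ++ ys′ → length xs ≤ length xs′ →
    ∃ λ r → xs′ ≡ xs ++ r
  ++-prefix []       ys xs′        ys′ _  _         = xs′ , refl
  ++-prefix (x ∷ xs) ys (x′ ∷ xs′) ys′ eq (s≤s le) with ∷-injective eq
  ... | refl , eq′ = map₂ (cong (x ∷_)) (++-prefix xs ys xs′ ys′ eq′ le)

  CommonRoot : Word A → Word A → Set
  CommonRoot u v = ∃ λ t → ∃₂ λ a b → u ≡ pow t a × v ≡ pow t b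

  -- Lyndon–Schützenberger; n bounds |u| + |v| to make the recursion structural.
  commute⇒CommonRoot : ∀ n (u v : Word A) → length u + length v ≤ n → u ++ v ≡ v ++ u → CommonRoot u v
  shorter-commute⇒CommonRoot : ∀ n (u v : Word A) → u ≢ [] → length u ≤ length v →
    length u + length v ≤ suc n → u ++ v ≡ v ++ u → CommonRoot u v

  commute⇒CommonRoot n       []          v           _     _  = v , 0 , 1 , refl , sym (++-identityʳ v)
  commute⇒CommonRoot n       u@(_ ∷ _) []          _     _  = u , 1 , 0 , sym (++-identityʳ u) , refl
  commute⇒CommonRoot (suc n) u@(_ ∷ _) v@(_ ∷ _) bound eq with ≤-total (length u) (length v)
  ... | inj₁ u≤v = shorter-commute⇒CommonRoot n u v (λ ()) u≤v bound eq
  ... | inj₂ v≤u = swap (shorter-commute⇒CommonRoot n v u (λ ()) v≤u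
                           (subst (_≤ suc n) (+-comm (length u) (length v)) bound) (sym eq))
    where
    swap : CommonRoot v u → CommonRoot u v
    swap (t , a , b , v≡ , u≡) = t , b , a , u≡ , v≡

  shorter-commute⇒CommonRoot n u v u≢[] u≤v bound eq with ++-prefix u v v u eq u≤v
  ... | r , refl = extend (commute⇒CommonRoot n u r bound′ (++-cancelˡ u (u ++ r) (r ++ u) (trans eq (++-assoc u r u))))
    where
    bound′ : length u + length r ≤ n
    bound′ = ≤-pred (≤-trans (+-monoˡ-≤ (length u + length r) (≢[]⇒0<length u≢[]))
                      (subst (_≤ suc n) (cong (length u +_) (length-++ u)) bound))

    extend : CommonRoot u r → CommonRoot u (u ++ r)
    extend (t , a , b , u≡ , r≡) = t , a , a + b , u≡ , trans (cong₂ _++_ u≡ r≡) (sym (pow-+ t a b))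

  commute⇒¬Primitive : ∀ (u v : Word A) → u ≢ [] → v ≢ [] → u ++ v ≡ v ++ u → ¬ Primitive (u ++ v)
  commute⇒¬Primitive u v u≢[] v≢[] eq (_ , not-power) with commute⇒CommonRoot _ u v ≤-refl eq
  ... | t , a , b , refl , refl =
    not-power (t , a + b , +-mono-≤ (1≤power a u≢[]) (1≤power b v≢[]) , sym (pow-+ t a b))
    where
    1≤power : ∀ a → pow t a ≢ [] → 1 ≤ a
    1≤power zero    ne = ⊥-elim (ne refl)
    1≤power (suc a) _  = s≤s z≤n

-- Lyndon words

module _ {A : Set} {_≺_ : A → A → Set} where

  private
    _≤ˡ_ : Word A → Word A → Set
    _≤ˡ_ = Lex-≤ _≡_ _≺_

  Lex-≤-prefix : ∀ (u s x y : Word A) → length u ≡ length s → (u ++ x) ≤ˡ (s ++ y) → u ≤ˡ s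
  Lex-≤-prefix []      []      x y _  _            = base _
  Lex-≤-prefix (a ∷ u) (b ∷ s) x y _  (this a≺b)   = this a≺b
  Lex-≤-prefix (a ∷ u) (b ∷ s) x y eq (next a≡b p) = next a≡b (Lex-≤-prefix u s x y (suc-injective eq) p)

  module _ (≺-spo : IsStrictPartialOrder _≡_ _≺_) where

    private
      module ≺ = IsStrictPartialOrder ≺-spo

    Lex-≤-cancelˡ : ∀ (v a b : Word A) → (v ++ a) ≤ˡ (v ++ b) → a ≤ˡ b
    Lex-≤-cancelˡ []      a b p           = p
    Lex-≤-cancelˡ (x ∷ v) a b (this x≺x)  = ⊥-elim (≺.irrefl refl x≺x)
    Lex-≤-cancelˡ (x ∷ v) a b (next _ p)  = Lex-≤-cancelˡ v a b p

    Lex-≤-antisym : ∀ {u v : Word A} → u ≤ˡ v → v ≤ˡ u → u ≡ v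
    Lex-≤-antisym u≤v v≤u = Pointwise-≡⇒≡ (≤-antisymmetric sym ≺.irrefl ≺.asym u≤v v≤u)

    Lyndon⇒≢[] : ∀ {z : Word A} → Lyndon _≺_ z → z ≢ []
    Lyndon⇒≢[] ((z≢[] , _) , _) = z≢[]

    Lyndon-rot-unique : ∀ {z z′ : Word A} {i} → Lyndon _≺_ z → Lyndon _≺_ z′ → i < length z →
      z′ ≡ rot i z → z′ ≡ z
    Lyndon-rot-unique {z} {i = zero}  _          _           _   refl = rot-zero z
    Lyndon-rot-unique {z} {i = suc i} (_ , z-min) (_ , z′-min) i<z refl =
      Lex-≤-antisym (subst (rot (suc i) z ≤ˡ_) (rot-rot (suc i) z) (z′-min (length z ∸ suc i) j<))
                    (z-min (suc i) i<z)
      where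
      j< : length z ∸ suc i < length (rot (suc i) z)
      j< = subst (length z ∸ suc i <_) (sym (length-rot (suc i) z)) (∸-monoʳ-< (s≤s z≤n) (<⇒≤ i<z))

    -- A border v of z (z = y v = v s) forces y ≤ s and s ≤ y, so y v = v y, contradicting primitivity.
    Lyndon-unbordered : ∀ {y v s : Word A} → Lyndon _≺_ (y ++ v) → y ++ v ≡ v ++ s →
      y ≢ [] → v ≢ [] → ⊥
    Lyndon-unbordered {y} {v} {s} (yv-primitive , minimal) yv≡vs y≢[] v≢[] =
      commute⇒¬Primitive y v y≢[] v≢[] yv≡vy yv-primitive
      where
      |y|+|v|≡|v|+|s| : length y + length v ≡ length v + length s
      |y|+|v|≡|v|+|s| = trans (sym (length-++ y)) (trans (cong length yv≡vs) (length-++ v))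

      |y|≡|s| : length y ≡ length s
      |y|≡|s| = +-cancelˡ-≡ (length v) _ _ (trans (+-comm (length v) (length y)) |y|+|v|≡|v|+|s|)

      |v|<|yv| : length v < length (y ++ v)
      |v|<|yv| = subst (length v <_) (sym (length-++ y)) (m<n+m (length v) (≢[]⇒0<length y≢[]))

      |y|<|yv| : length y < length (y ++ v)
      |y|<|yv| = subst (length y <_) (sym (length-++ y)) (m<m+n (length y) (≢[]⇒0<length v≢[]))

      y≤s : y ≤ˡ s
      y≤s = Lex-≤-prefix y s v v |y|≡|s|
              (subst ((y ++ v) ≤ˡ_) (trans (cong (rot (length v)) yv≡vs) (rot-++ v s))
                 (minimal (length v) |v|<|yv|))

      s≤y : s ≤ˡ y
      s≤y = Lex-≤-cancelˡ v s y
              (subst (_≤ˡ (v ++ y)) yv≡vs (subst ((y ++ v) ≤ˡ_) (rot-++ y v) (minimal (length y) |y|<|yv|)))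

      yv≡vy : y ++ v ≡ v ++ y
      yv≡vy = trans yv≡vs (cong (v ++_) (Lex-≤-antisym s≤y y≤s))

    -- z′ is a prefix of (rot i z)^ω, hence of the form rot i z · v with v a prefix of z′:
    -- v = [] makes z′ a rotation of z, and v ≠ [] would be a border of z′.
    Lyndon-powPrefix-unique : ∀ {z z′ : Word A} {m} → Lyndon _≺_ z → Lyndon _≺_ z′ →
      length z ≤ length z′ → length z′ ≤ m → InZm z m (powPrefix z′ m) → z′ ≡ z
    Lyndon-powPrefix-unique {z} {z′} {m} Lz Lz′ |z|≤|z′| |z′|≤m (i , i<|z| , z′^m≡y^m) =
      split (length z′ ∸ length y) z′≡y++v
      where
      y : Word A
      y = rot i z

      y≢[] : y ≢ []
      y≢[] = rot-≢[] i (Lyndon⇒≢[] Lz)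

      |y|≤|z′| : length y ≤ length z′
      |y|≤|z′| = subst (_≤ length z′) (sym (length-rot i z)) |z|≤|z′|

      z′≡prefix : z′ ≡ take (length z′) (powPrefix y m)
      z′≡prefix = trans (sym (take-powPrefix z′ |z′|≤m)) (cong (take (length z′)) z′^m≡y^m)

      z′≡y++v : z′ ≡ y ++ take (length z′ ∸ length y) z′
      z′≡y++v = subst (λ x → x ≡ y ++ take (length z′ ∸ length y) x) (sym z′≡prefix)
                  (take-powPrefix-period y≢[] |y|≤|z′| |z′|≤m)

      split : ∀ k → z′ ≡ y ++ take k z′ → z′ ≡ z
      split zero    eq = Lyndon-rot-unique Lz Lz′ i<|z| (trans eq (++-identityʳ y))
      split (suc k) eq = ⊥-elim (Lyndon-unbordered (subst (Lyndon _≺_) eq Lz′)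
        (trans (sym eq) (sym (take++drop≡id (suc k) z′))) y≢[] (take-suc-≢[] (Lyndon⇒≢[] Lz′)))

-- Arcs of [z]_m and circuits

module _ {A : Set} where

  open ≡-Reasoning

  ↭-take-init⇒≡ : ∀ ℓ (xs ys : List A) → length xs ≡ suc ℓ → length ys ≡ suc ℓ →
    take ℓ xs ≡ take ℓ ys → xs ↭ ys → xs ≡ ys
  ↭-take-init⇒≡ zero    (x ∷ []) (y ∷ []) _    _    _  xs↭ys = sym (↭-singleton-inv (↭-sym xs↭ys))
  ↭-take-init⇒≡ (suc ℓ) (x ∷ xs) (y ∷ ys) |xs| |ys| eq xs↭ys with ∷-injective eq
  ... | refl , eq′ =
    cong (x ∷_) (↭-take-init⇒≡ ℓ xs ys (suc-injective |xs|) (suc-injective |ys|) eq′ (drop-∷ xs↭ys))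

  -- If |z| ≤ ℓ a word of [z]_{ℓ+1} is determined by its length-|z| prefix, otherwise it is a
  -- rotation of z, i.e. a permutation of z, and the last letter is then forced.
  InZm-take-injective : ∀ {z : Word A} {ℓ u u′} → length z ≤ suc ℓ →
    InZm z (suc ℓ) u → InZm z (suc ℓ) u′ → take ℓ u ≡ take ℓ u′ → u ≡ u′
  InZm-take-injective {z} {ℓ} |z|≤1+ℓ (i , _ , refl) (j , _ , refl) eq with m≤n⇒m<n∨m≡n |z|≤1+ℓ
  ... | inj₁ (s≤s |z|≤ℓ) = cong (λ y → powPrefix y (suc ℓ)) (begin
    rot i z                                               ≡⟨ prefix-rot i ⟨
    take (length z) (powPrefix (rot i z) (suc ℓ))         ≡⟨ take-take-≤ _ |z|≤ℓ ⟨
    take (length z) (take ℓ (powPrefix (rot i z) (suc ℓ))) ≡⟨ cong (take (length z)) eq ⟩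
    take (length z) (take ℓ (powPrefix (rot j z) (suc ℓ))) ≡⟨ take-take-≤ _ |z|≤ℓ ⟩
    take (length z) (powPrefix (rot j z) (suc ℓ))         ≡⟨ prefix-rot j ⟩
    rot j z                                               ∎)
    where
    prefix-rot : ∀ k → take (length z) (powPrefix (rot k z) (suc ℓ)) ≡ rot k z
    prefix-rot k = subst (λ n → take n (powPrefix (rot k z) (suc ℓ)) ≡ rot k z) (length-rot k z)
                     (take-powPrefix (rot k z) (subst (_≤ suc ℓ) (sym (length-rot k z)) |z|≤1+ℓ))
  ... | inj₂ |z|≡1+ℓ = begin
    powPrefix (rot i z) (suc ℓ)   ≡⟨ powPrefix-rot i ⟩
    rot i z                       ≡⟨ ↭-take-init⇒≡ ℓ _ _ (|rot|≡ i) (|rot|≡ j) eq′ rots↭ ⟩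
    rot j z                       ≡⟨ powPrefix-rot j ⟨
    powPrefix (rot j z) (suc ℓ)   ∎
    where
    |rot|≡ : ∀ k → length (rot k z) ≡ suc ℓ
    |rot|≡ k = trans (length-rot k z) |z|≡1+ℓ

    powPrefix-rot : ∀ k → powPrefix (rot k z) (suc ℓ) ≡ rot k z
    powPrefix-rot k = subst (λ n → powPrefix (rot k z) n ≡ rot k z) (|rot|≡ k) (powPrefix-length (rot k z))

    eq′ : take ℓ (rot i z) ≡ take ℓ (rot j z)
    eq′ = trans (cong (take ℓ) (sym (powPrefix-rot i))) (trans eq (cong (take ℓ) (powPrefix-rot j)))

    rots↭ : rot i z ↭ rot j z
    rots↭ = ↭-trans (rot-↭ i z) (↭-sym (rot-↭ j z))

module _ {B : Set} {R : B → B → Set} where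

  Linked-split : ∀ xs {y : B} ys → Linked R (xs ++ y ∷ ys) → Linked R (xs ++ [ y ]) × Linked R (y ∷ ys)
  Linked-split []            ys l       = [-] , l
  Linked-split (x ∷ [])      ys (r ∷ l) = r ∷ [-] , l
  Linked-split (x ∷ x′ ∷ xs) ys (r ∷ l) = map₁ (r ∷_) (Linked-split (x′ ∷ xs) ys l)

  Linked-join : ∀ xs {y : B} ys → Linked R (xs ++ [ y ]) → Linked R (y ∷ ys) → Linked R (xs ++ y ∷ ys)
  Linked-join []            ys _        l₂ = l₂
  Linked-join (x ∷ [])      ys (r ∷ _)  l₂ = r ∷ l₂
  Linked-join (x ∷ x′ ∷ xs) ys (r ∷ l₁) l₂ = r ∷ Linked-join (x′ ∷ xs) ys l₁ l₂

  module _ {P : B → Set} (R-deterministic : ∀ {a b b′} → P b → P b′ → R a b → R a b′ → b ≡ b′)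
    where

    Linked-unique : ∀ {x e : B} xs ys → Linked R (x ∷ xs ++ [ e ]) → Linked R (x ∷ ys ++ [ e ]) →
      e ∉ xs → e ∉ ys → P e → All P xs → All P ys → xs ≡ ys
    Linked-unique []       []       _       _        _    _    _  _         _        = refl
    Linked-unique []       (y ∷ ys) (r ∷ _) (r′ ∷ _) _    e∉ys Pe _         (Py ∷ _) =
      ⊥-elim (e∉ys (here (R-deterministic Pe Py r r′)))
    Linked-unique (y ∷ xs) []       (r ∷ _) (r′ ∷ _) e∉xs _    Pe (Py ∷ _)  _        =
      ⊥-elim (e∉xs (here (R-deterministic Pe Py r′ r)))
    Linked-unique (a ∷ xs) (b ∷ ys) (r ∷ l) (r′ ∷ l′) e∉xs e∉ys Pe (Pa ∷ Pxs) (Pb ∷ Pys)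
      with R-deterministic Pa Pb r r′
    ... | refl =
      cong (a ∷_) (Linked-unique xs ys l l′ (λ e∈ → e∉xs (there e∈)) (λ e∈ → e∉ys (there e∈)) Pe Pxs Pys)

module _ {B : Set} where

  ↭-rotate : ∀ c₁ (x : B) c₂ → x ∷ c₂ ++ c₁ ↭ c₁ ++ x ∷ c₂
  ↭-rotate c₁ x c₂ = subst (_↭ c₁ ++ x ∷ c₂) (rot-++ c₁ (x ∷ c₂)) (rot-↭ (length c₁) (c₁ ++ x ∷ c₂))

  ∈-rotate : ∀ c₁ {x : B} c₂ {b} → b ∈ c₂ ++ c₁ → b ∈ c₁ ++ x ∷ c₂
  ∈-rotate c₁ c₂ b∈ = ∈-resp-↭ (↭-rotate c₁ _ c₂) (there b∈)

  Unique-rotate : ∀ c₁ {x : B} c₂ → Unique (c₁ ++ x ∷ c₂) → x ∉ c₂ ++ c₁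
  Unique-rotate c₁ c₂ !c =
    Unique[x∷xs]⇒x∉xs (PermS.Unique-resp-↭ (setoid B) (↭⇒↭ₛ (↭-sym (↭-rotate c₁ _ c₂))) !c)

  All-rotate : ∀ {P : B → Set} c₁ {x : B} c₂ → All P (c₁ ++ x ∷ c₂) → All P (c₂ ++ c₁)
  All-rotate c₁ c₂ Pc = All.tail (All-resp-↭ (↭-sym (↭-rotate c₁ _ c₂)) Pc)

module _ {A : Set} {ℓ : ℕ} where

  ClosedWalk-rotate : ∀ c₁ (x : Word A) c₂ →
    ClosedWalk ℓ (c₁ ++ x ∷ c₂) → ClosedWalk ℓ (x ∷ c₂ ++ c₁)
  ClosedWalk-rotate []       x c₂ cw = subst (λ c → ClosedWalk ℓ (x ∷ c)) (sym (++-identityʳ c₂)) cw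
  ClosedWalk-rotate (a ∷ c₁) x c₂ cw =
    subst (Linked (Adj ℓ)) (cong (x ∷_) (sym (++-assoc c₂ (a ∷ c₁) [ x ])))
      (Linked-join (x ∷ c₂) (c₁ ++ [ x ]) (proj₂ split) (proj₁ split))
    where
    split : Linked (Adj ℓ) ((a ∷ c₁) ++ [ x ]) × Linked (Adj ℓ) (x ∷ c₂ ++ [ a ])
    split = Linked-split (a ∷ c₁) (c₂ ++ [ a ])
              (subst (Linked (Adj ℓ)) (cong (a ∷_) (++-assoc c₁ (x ∷ c₂) [ a ])) cw)

  ClosedWalk-shared-arc⇒SameCircuit : ∀ {P : Word A → Set} →
    (∀ {a b b′} → P b → P b′ → Adj ℓ a b → Adj ℓ a b′ → b ≡ b′) →
    ∀ {c x xs} → x ∈ c → ClosedWalk ℓ c → ClosedWalk ℓ (x ∷ xs) → Unique c → Unique (x ∷ xs) →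
    All P c → All P (x ∷ xs) → SameCircuit c (x ∷ xs)
  ClosedWalk-shared-arc⇒SameCircuit det {x = x} {xs} x∈c cw cw′ !c !x∷xs Pc (Px ∷ Pxs) with ∈-∃++ x∈c
  ... | c₁ , c₂ , refl = length c₁ , sym (trans (rot-++ c₁ (x ∷ c₂)) (cong (x ∷_) c₂c₁≡xs))
    where
    c₂c₁≡xs : c₂ ++ c₁ ≡ xs
    c₂c₁≡xs = Linked-unique (λ {a} → det {a}) (c₂ ++ c₁) xs (ClosedWalk-rotate c₁ x c₂ cw) cw′
      (Unique-rotate c₁ c₂ !c) (Unique[x∷xs]⇒x∉xs !x∷xs) Px (All-rotate c₁ c₂ Pc) Pxs

-- Undirected reachability

module _ {V : Set} where

  data Path (E : List (V × V)) : V → V → Set where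
    stop : ∀ {x} → Path E x x
    fwd  : ∀ {x y z} → (x , y) ∈ E → Path E y z → Path E x z
    bwd  : ∀ {x y z} → (y , x) ∈ E → Path E y z → Path E x z

  infixr 5 _++ₚ_

  _++ₚ_ : ∀ {E x y z} → Path E x y → Path E y z → Path E x z
  stop    ++ₚ q = q
  fwd e p ++ₚ q = fwd e (p ++ₚ q)
  bwd e p ++ₚ q = bwd e (p ++ₚ q)

  reverseₚ : ∀ {E x y} → Path E x y → Path E y x
  reverseₚ stop      = stop
  reverseₚ (fwd e p) = reverseₚ p ++ₚ bwd e stop
  reverseₚ (bwd e p) = reverseₚ p ++ₚ fwd e stop

  edgeₚ : ∀ {E x y} → (x , y) ∈ E → Path E x y
  edgeₚ e = fwd e stop

  Path-[] : ∀ {x y} → Path [] x y → x ≡ y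
  Path-[] stop = refl

  Path-remove-edge : ∀ {x y E v s} → Path ((x , y) ∷ E) v s →
    Path E v s ⊎ ((Path E v x ⊎ Path E v y) × (Path E x s ⊎ Path E y s))
  Path-remove-edge stop = inj₁ stop
  Path-remove-edge (fwd (here refl) p) with Path-remove-edge p
  ... | inj₁ q       = inj₂ (inj₁ stop , inj₂ q)
  ... | inj₂ (_ , q) = inj₂ (inj₁ stop , q)
  Path-remove-edge (bwd (here refl) p) with Path-remove-edge p
  ... | inj₁ q       = inj₂ (inj₂ stop , inj₁ q)
  ... | inj₂ (_ , q) = inj₂ (inj₂ stop , q)
  Path-remove-edge (fwd (there e) p) with Path-remove-edge p
  ... | inj₁ q            = inj₁ (fwd e q)
  ... | inj₂ (inj₁ a , q) = inj₂ (inj₁ (fwd e a) , q)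
  ... | inj₂ (inj₂ a , q) = inj₂ (inj₂ (fwd e a) , q)
  Path-remove-edge (bwd (there e) p) with Path-remove-edge p
  ... | inj₁ q            = inj₁ (bwd e q)
  ... | inj₂ (inj₁ a , q) = inj₂ (inj₁ (bwd e a) , q)
  ... | inj₂ (inj₂ a , q) = inj₂ (inj₂ (bwd e a) , q)

  Reach : List (V × V) → List V → V → Set
  Reach E S v = ∃ λ s → s ∈ S × Path E v s

  -- Deleting an edge (x , y) costs at most one new root: y if x still reaches y ∷ S, x otherwise.
  -- Reachability need not be decidable, but the goal is, so excluded middle for it is available
  -- under a double negation.
  Reach⇒length≤ : ∀ E (Vs S : List V) → Unique Vs → (∀ {v} → v ∈ Vs → Reach E S v) →
    length Vs ≤ length E + length S
  Reach⇒length≤ [] Vs S !Vs reach = Unique-⊆⇒length≤ !Vs λ v∈ →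
    let s , s∈ , p = reach v∈ in subst (_∈ S) (sym (Path-[] p)) s∈
  Reach⇒length≤ ((x , y) ∷ E) Vs S !Vs reach =
    decidable-stable (length Vs ≤? suc (length E + length S)) λ ≰ →
      ¬¬-excluded-middle λ where
        (yes x↝yS) → ≰ (with-root y (λ v∈ → reroute-y x↝yS (reach v∈)))
        (no  x↛yS) → ≰ (with-root x (λ v∈ → reroute-x x↛yS (reach v∈)))
    where
    with-root : ∀ r → (∀ {v} → v ∈ Vs → Reach E (r ∷ S) v) → length Vs ≤ suc (length E + length S)
    with-root r reach′ =
      ≤-trans (Reach⇒length≤ E Vs (r ∷ S) !Vs reach′) (≤-reflexive (+-suc (length E) (length S)))

    reroute-y : Reach E (y ∷ S) x → ∀ {v} → Reach ((x , y) ∷ E) S v → Reach E (y ∷ S) v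
    reroute-y (s′ , s′∈ , x↝s′) (s , s∈ , p) with Path-remove-edge p
    ... | inj₁ q              = s , there s∈ , q
    ... | inj₂ (inj₁ v↝x , _) = s′ , s′∈ , v↝x ++ₚ x↝s′
    ... | inj₂ (inj₂ v↝y , _) = y , here refl , v↝y

    reroute-x : ¬ Reach E (y ∷ S) x → ∀ {v} → Reach ((x , y) ∷ E) S v → Reach E (x ∷ S) v
    reroute-x x↛yS (s , s∈ , p) with Path-remove-edge p
    ... | inj₁ q                     = s , there s∈ , q
    ... | inj₂ (inj₁ v↝x , _)        = x , here refl , v↝x
    ... | inj₂ (inj₂ _ , inj₁ x↝s)   = ⊥-elim (x↛yS (s , there s∈ , x↝s))
    ... | inj₂ (inj₂ v↝y , inj₂ y↝s) = s , there s∈ , v↝y ++ₚ y↝s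

-- Factors and the Rauzy graph

module _ {A : Set} where

  factors : Word A → List (Word A)
  factors w = concatMap inits (tails w)

  ∈-inits⁺ : ∀ {u s xs : Word A} → u ++ s ≡ xs → u ∈ inits xs
  ∈-inits⁺ {[]}    refl = here refl
  ∈-inits⁺ {x ∷ u} refl = there (∈-map⁺ (x ∷_) (∈-inits⁺ refl))

  ∈-inits⁻ : ∀ {u} (xs : Word A) → u ∈ inits xs → ∃ λ s → u ++ s ≡ xs
  ∈-inits⁻ xs       (here refl) = xs , refl
  ∈-inits⁻ (x ∷ xs) (there u∈)  with ∈-map⁻ (x ∷_) u∈
  ... | _ , u∈′ , refl = map₂ (cong (x ∷_)) (∈-inits⁻ xs u∈′)

  ∈-factors⁺ : ∀ {u w : Word A} → Factor u w → u ∈ factors w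
  ∈-factors⁺         ([]    , s , eq) = ∈-++⁺ˡ (∈-inits⁺ eq)
  ∈-factors⁺ {w = x ∷ w} (_ ∷ p , s , eq) =
    ∈-++⁺ʳ (inits (x ∷ w)) (∈-factors⁺ (p , s , proj₂ (∷-injective eq)))

  ∈-factors⁻ : ∀ {u} (w : Word A) → u ∈ factors w → Factor u w
  ∈-factors⁻ w u∈ with ∈-++⁻ (inits w) u∈
  ∈-factors⁻ w       u∈ | inj₁ u∈inits = [] , ∈-inits⁻ w u∈inits
  ∈-factors⁻ (x ∷ w) u∈ | inj₂ u∈rest  with ∈-factors⁻ w u∈rest
  ... | p , s , eq = x ∷ p , s , cong (x ∷_) eq

  Factor⇒length≤ : ∀ {v w : Word A} → Factor v w → length v ≤ length w
  Factor⇒length≤ {v} (p , s , refl) = ≤-trans (length-++-≤ˡ v) (length-++-≤ʳ (v ++ s) {p})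

module _ {A : Set} where

  src tgt : Word A → Word A
  src a = take (length a ∸ 1) a
  tgt a = drop 1 a

  src-length : ∀ {ℓ} {a : Word A} → length a ≡ suc ℓ → src a ≡ take ℓ a
  src-length {a = a} eq = cong (λ k → take (k ∸ 1) a) eq

  Linked-Adj⇒Path : ∀ {E ℓ} {x z : Word A} ys → Linked (Adj ℓ) (x ∷ ys ++ [ z ]) →
    (∀ {b} → b ∈ ys → Path E (take ℓ b) (tgt b)) → Path E (tgt x) (take ℓ z)
  Linked-Adj⇒Path []       (r ∷ _) _     = subst (Path _ _) r stop
  Linked-Adj⇒Path (b ∷ ys) (r ∷ l) paths =
    subst (λ v → Path _ v _) (sym r)
      (paths (here refl) ++ₚ Linked-Adj⇒Path ys l (λ b∈ → paths (there b∈)))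

  ClosedWalk-bypass : ∀ {E ℓ} {c : List (Word A)} {a} → a ∈ c → ClosedWalk ℓ c → Unique c →
    All (λ b → length b ≡ suc ℓ) c → (∀ {b} → b ∈ c → b ≢ a → Path E (src b) (tgt b)) →
    Path E (src a) (tgt a)
  ClosedWalk-bypass {E} {ℓ} {a = a} a∈c cw !c |c| others with ∈-∃++ a∈c
  ... | c₁ , c₂ , refl = subst (λ v → Path E v (tgt a)) (sym (src-length (All.lookup |c| a∈c)))
    (reverseₚ (Linked-Adj⇒Path (c₂ ++ c₁) (ClosedWalk-rotate c₁ a c₂ cw) other-path))
    where
    other-path : ∀ {b} → b ∈ c₂ ++ c₁ → Path E (take ℓ b) (tgt b)
    other-path {b} b∈ = subst (λ v → Path E v (tgt b)) (src-length (All.lookup |c| (∈-rotate c₁ c₂ b∈)))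
      (others (∈-rotate c₁ c₂ b∈) (λ b≡a → Unique-rotate c₁ c₂ !c (subst (_∈ c₂ ++ c₁) b≡a b∈)))

  -- The arcs w[i] w[i+1..i+|v|] lead from an occurrence of v in w back to the prefix of w of length |v|.
  Path-to-prefix : ∀ {E} (w : Word A) → (∀ {a} → a ≢ [] → Factor a w → Path E (src a) (tgt a)) →
    ∀ p {v} s → p ++ v ++ s ≡ w → Path E v (take (length v) w)
  Path-to-prefix w       _    []      {v} s refl = subst (Path _ v) (sym (take-length-++ v s)) stop
  Path-to-prefix (x ∷ w) arc-paths (_ ∷ p) {v} s eq with ∷-injective eq
  ... | refl , eq′ =
    Path-to-prefix w arc-paths′ p s eq′ ++ₚ reverseₚ (subst (λ u → Path _ u _) src≡ (arc-paths (λ ()) a-factor))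
    where
    arc-paths′ : ∀ {a} → a ≢ [] → Factor a w → Path _ (src a) (tgt a)
    arc-paths′ a≢[] (p′ , s′ , e) = arc-paths a≢[] (x ∷ p′ , s′ , cong (x ∷_) e)

    a : Word A
    a = x ∷ take (length v) w

    a-factor : Factor a (x ∷ w)
    a-factor = [] , drop (length v) w , cong (x ∷_) (take++drop≡id (length v) w)

    src≡ : src a ≡ take (length v) (x ∷ w)
    src≡ = trans (cong (λ k → take k a) (length-take-≤ w (Factor⇒length≤ (p , s , eq′))))
                 (take-take-≤ (x ∷ w) (n≤1+n (length v)))

-- Representatives of Lyndon circuits

module LyndonCircuits {A : Set} {_≺_ : A → A → Set} (≺-sto : IsStrictTotalOrder _≡_ _≺_) (w : Word A) where

  private
    module ≺ = IsStrictTotalOrder ≺-sto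

    ≺-spo : IsStrictPartialOrder _≡_ _≺_
    ≺-spo = ≺.isStrictPartialOrder

  _≟ʷ_ : DecidableEquality (Word A)
  _≟ʷ_ = ≡-dec ≺._≟_

  open import Data.List.Membership.DecPropositional _≟ʷ_ using (_∈?_)

  -- An element of CS_w(z), with m normalised to the common length level + 1 of its arcs.
  record LyndonCircuit : Set where
    field
      arcs        : List (Word A)
      root        : Word A
      level       : ℕ
      root-Lyndon : Lyndon _≺_ root
      |root|≤     : length root ≤ suc level
      arcs-in-Γ   : All (λ a → length a ≡ suc level × Factor a w) arcs
      closed      : ClosedWalk level arcs
      unique      : Unique arcs
      arcs≡[root] : ∀ u → (u ∈ arcs) ⇔ InZm root (suc level) u

  open LyndonCircuit

  fromInUnionCS : ∀ {c} → InUnionCS _≺_ w c → LyndonCircuit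
  fromInUnionCS {c} (z , (_ , Lz) , (ℓ , _ , c-in-Γ , cw , !c) , m , |z|≤m , c≡[z]ₘ) = record
    { arcs = c ; root = z ; level = ℓ ; root-Lyndon = Lz ; |root|≤ = subst (length z ≤_) m≡1+ℓ |z|≤m
    ; arcs-in-Γ = c-in-Γ ; closed = cw ; unique = !c
    ; arcs≡[root] = subst (λ n → ∀ u → (u ∈ c) ⇔ InZm z n u) m≡1+ℓ c≡[z]ₘ }
    where
    z≢[] : z ≢ []
    z≢[] = Lyndon⇒≢[] ≺-spo Lz

    m≡1+ℓ : m ≡ suc ℓ
    m≡1+ℓ = trans (sym (length-powPrefix m z≢[]))
                  (proj₁ (All.lookup c-in-Γ (Equivalence.from (c≡[z]ₘ _) (powPrefix∈[z] z≢[]))))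

  arc-length : ∀ L {a} → a ∈ arcs L → length a ≡ suc (level L)
  arc-length L a∈ = proj₁ (All.lookup (arcs-in-Γ L) a∈)

  arc-factor : ∀ L {a} → a ∈ arcs L → Factor a w
  arc-factor L a∈ = proj₂ (All.lookup (arcs-in-Γ L) a∈)

  arc≢[] : ∀ L {a} → a ∈ arcs L → a ≢ []
  arc≢[] L a∈ a≡[] with trans (sym (arc-length L a∈)) (cong length a≡[])
  ... | ()

  arc∈[root] : ∀ L {a} → a ∈ arcs L → InZm (root L) (suc (level L)) a
  arc∈[root] L = Equivalence.to (arcs≡[root] L _)

  representative : LyndonCircuit → Word A
  representative L = powPrefix (root L) (suc (level L))

  representative∈arcs : ∀ L → representative L ∈ arcs L
  representative∈arcs L =
    Equivalence.from (arcs≡[root] L _) (powPrefix∈[z] (Lyndon⇒≢[] ≺-spo (root-Lyndon L)))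

  length-representative : ∀ L → length (representative L) ≡ suc (level L)
  length-representative L = length-powPrefix (suc (level L)) (Lyndon⇒≢[] ≺-spo (root-Lyndon L))

  representative∈arcs⇒same-root : ∀ L L′ → representative L′ ∈ arcs L → length (root L) ≤ length (root L′) →
    root L′ ≡ root L × level L′ ≡ level L
  representative∈arcs⇒same-root L L′ r∈ |z|≤|z′| = root≡ , suc-injective level≡
    where
    level≡ : suc (level L′) ≡ suc (level L)
    level≡ = trans (sym (length-representative L′)) (arc-length L r∈)

    root≡ : root L′ ≡ root L
    root≡ = Lyndon-powPrefix-unique ≺-spo (root-Lyndon L) (root-Lyndon L′) |z|≤|z′|
              (subst (length (root L′) ≤_) level≡ (|root|≤ L′))
              (subst (λ n → InZm (root L) (suc (level L)) (powPrefix (root L′) n)) level≡ (arc∈[root] L r∈))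

  representative∈arcs⇒shorter-root : ∀ L L′ → representative L′ ∈ arcs L →
    representative L′ ≢ representative L → length (root L′) < length (root L)
  representative∈arcs⇒shorter-root L L′ r∈ r≢ with length (root L) ≤? length (root L′)
  ... | no  |z|≰|z′| = ≰⇒> |z|≰|z′|
  ... | yes |z|≤|z′| with representative∈arcs⇒same-root L L′ r∈ |z|≤|z′|
  ...   | root≡ , level≡ = ⊥-elim (r≢ (cong₂ (λ z ℓ → powPrefix z (suc ℓ)) root≡ level≡))

  circuit-unique : ∀ {z : Word A} {ℓ} {c c′ : List (Word A)} → length z ≤ suc ℓ →
    ClosedWalk ℓ c → ClosedWalk ℓ c′ → Unique c → Unique c′ →
    (∀ u → (u ∈ c) ⇔ InZm z (suc ℓ) u) → (∀ {u} → u ∈ c′ → InZm z (suc ℓ) u) → SameCircuit c c′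
  circuit-unique {z} {ℓ} {c′ = x ∷ xs} |z|≤ cw cw′ !c !c′ c≡[z] c′⊆[z] =
    ClosedWalk-shared-arc⇒SameCircuit (λ {a} → adj-deterministic {a})
      (Equivalence.from (c≡[z] x) (c′⊆[z] (here refl))) cw cw′ !c !c′
      (All.tabulate (Equivalence.to (c≡[z] _))) (All.tabulate c′⊆[z])
    where
    adj-deterministic : ∀ {a b b′} → InZm z (suc ℓ) b → InZm z (suc ℓ) b′ →
      Adj ℓ a b → Adj ℓ a b′ → b ≡ b′
    adj-deterministic b∈ b′∈ ab ab′ = InZm-take-injective |z|≤ b∈ b′∈ (trans (sym ab) ab′)

  same-representative⇒SameCircuit : ∀ L L′ → representative L ≡ representative L′ →
    SameCircuit (arcs L) (arcs L′)
  same-representative⇒SameCircuit L L′ eq = circuit-unique (|root|≤ L) (closed L)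
    (subst (λ ℓ → ClosedWalk ℓ (arcs L′)) level≡ (closed L′)) (unique L) (unique L′) (arcs≡[root] L)
    (λ u∈ → subst₂ (λ z ℓ → InZm z (suc ℓ) _) root≡ level≡ (arc∈[root] L′ u∈))
    where
    same-root : root L′ ≡ root L × level L′ ≡ level L
    same-root with ≤-total (length (root L)) (length (root L′))
    ... | inj₁ ≤ = representative∈arcs⇒same-root L L′ (subst (_∈ arcs L) eq (representative∈arcs L)) ≤
    ... | inj₂ ≥ = map₁ sym (map₂ sym (representative∈arcs⇒same-root L′ L
                     (subst (_∈ arcs L′) (sym eq) (representative∈arcs L′)) ≥))

    root≡ : root L′ ≡ root L
    root≡ = proj₁ same-root

    level≡ : level L′ ≡ level L
    level≡ = proj₂ same-root

  module _ (Ls : List LyndonCircuit) where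

    representatives : List (Word A)
    representatives = map representative Ls

    -- The Rauzy graph Γ_w with the representatives deleted, viewed as an undirected graph.
    Kept : Word A → Set
    Kept a = a ≢ [] × a ∉ representatives

    kept? : Decidable Kept
    kept? a = ¬? (a ≟ʷ []) ×-dec ¬? (a ∈? representatives)

    vertices : List (Word A)
    vertices = deduplicate _≟ʷ_ (factors w)

    edges : List (Word A × Word A)
    edges = map (λ a → src a , tgt a) (filter kept? vertices)

    -- A deleted representative is bypassed by the other arcs of its circuit; those that are deleted
    -- too represent circuits with a shorter Lyndon root, which bounds the recursion.
    arc-path : ∀ n {a} → a ≢ [] → Factor a w →
      (∀ {L} → L ∈ Ls → a ≡ representative L → length (root L) < n) → Path edges (src a) (tgt a)
    arc-path n {a} a≢[] a∈F shorter with a ∈? representatives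
    ... | no a∉R = edgeₚ (∈-map⁺ _ (∈-filter⁺ kept? (∈-deduplicate⁺ _≟ʷ_ (∈-factors⁺ a∈F)) (a≢[] , a∉R)))
    ... | yes a∈R with ∈-map⁻ representative a∈R
    ...   | L , L∈ , refl with n | shorter L∈ refl
    ...     | suc n′ | |z|<1+n′ =
      ClosedWalk-bypass (representative∈arcs L) (closed L) (unique L) (All.map proj₁ (arcs-in-Γ L)) λ b∈ b≢ →
        arc-path n′ (arc≢[] L b∈) (arc-factor L b∈) λ { {L′} _ refl →
          ≤-trans (representative∈arcs⇒shorter-root L L′ b∈ b≢) (≤-pred |z|<1+n′) }

    representatives-bound : Unique representatives → length representatives ≤ length w
    representatives-bound !R = ≤-pred (+-cancelˡ-≤ (length kept) _ _ (begin
      length kept + suc (length representatives)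
        ≤⟨ +-monoʳ-≤ (length kept) (Unique-⊆⇒length≤ !deleted deleted⊆) ⟩
      length kept + length (filter (∁? kept?) vertices) ≡⟨ length-filter+length-filter-∁ kept? vertices ⟩
      length vertices ≤⟨ Reach⇒length≤ edges vertices (inits w) (deduplicate-! _≟ʷ_ (factors w)) reach ⟩
      length edges + length (inits w) ≡⟨ cong₂ _+_ (length-map _ kept) (length-inits w) ⟩
      length kept + suc (length w) ∎))
      where
      open ≤-Reasoning

      kept : List (Word A)
      kept = filter kept? vertices

      factor∈vertices : ∀ {v} → Factor v w → v ∈ vertices
      factor∈vertices v∈F = ∈-deduplicate⁺ _≟ʷ_ (∈-factors⁺ v∈F)

      reach : ∀ {v} → v ∈ vertices → Reach edges (inits w) v
      reach {v} v∈ with ∈-factors⁻ w (∈-deduplicate⁻ _≟ʷ_ (factors w) v∈)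
      ... | p , s , eq = take (length v) w , ∈-inits⁺ (take++drop≡id (length v) w) ,
        Path-to-prefix w (λ {a} a≢[] a∈F → arc-path (suc (length a)) a≢[] a∈F λ { {L} _ refl → s≤s (|root|≤′ L) })
          p s eq
        where
        |root|≤′ : ∀ L → length (root L) ≤ length (representative L)
        |root|≤′ L = subst (length (root L) ≤_) (sym (length-representative L)) (|root|≤ L)

      deleted : List (Word A)
      deleted = [] ∷ representatives

      !deleted : Unique deleted
      !deleted = All.tabulate (λ r∈ []≡r → rep≢[] r∈ (sym []≡r)) ∷ !R
        where
        rep≢[] : ∀ {r} → r ∈ representatives → r ≢ []
        rep≢[] r∈ with ∈-map⁻ representative r∈
        ... | L , _ , refl = arc≢[] L (representative∈arcs L)

      deleted⊆ : deleted ⊆ filter (∁? kept?) vertices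
      deleted⊆ (here refl) = ∈-filter⁺ (∁? kept?) (factor∈vertices ([] , w , refl)) (λ k → proj₁ k refl)
      deleted⊆ (there r∈) with ∈-map⁻ representative r∈
      ... | L , _ , refl =
        ∈-filter⁺ (∁? kept?) (factor∈vertices (arc-factor L (representative∈arcs L))) (λ k → proj₂ k r∈)

  lyndonCircuits : ∀ {cs} → All (InUnionCS _≺_ w) cs → List LyndonCircuit
  lyndonCircuits = All.reduce fromInUnionCS

  map-arcs-lyndonCircuits : ∀ {cs} (cs∈ : All (InUnionCS _≺_ w) cs) → map arcs (lyndonCircuits cs∈) ≡ cs
  map-arcs-lyndonCircuits []        = refl
  map-arcs-lyndonCircuits (_ ∷ cs∈) = cong (_ ∷_) (map-arcs-lyndonCircuits cs∈)

  distinct⇒Unique-representatives : ∀ Ls → AllPairs (λ c c′ → ¬ SameCircuit c c′) (map arcs Ls) →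
    Unique (representatives Ls)
  distinct⇒Unique-representatives Ls distinct = AllPairsₚ.map⁺ (AllPairs.map
    (λ {L} {L′} ¬same eq → ¬same (same-representative⇒SameCircuit L L′ eq)) (AllPairsₚ.map⁻ distinct))

lemma6 : {A : Set} (_<_ : A → A → Set) → IsStrictTotalOrder _≡_ _<_ →
    (w : Word A) (cs : List (List (Word A))) →
    All (InUnionCS _<_ w) cs →
    AllPairs (λ c c′ → ¬ SameCircuit c c′) cs →
    length cs ≤ length w
lemma6 _<_ <-sto w cs cs∈ distinct = begin
  length cs                    ≡⟨ cong length (map-arcs-lyndonCircuits cs∈) ⟨
  length (map arcs Ls)         ≡⟨ length-map arcs Ls ⟩
  length Ls                    ≡⟨ length-map representative Ls ⟨
  length (representatives Ls)  ≤⟨ representatives-bound Ls (distinct⇒Unique-representatives Ls distinct′) ⟩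
  length w                     ∎
  where
  open LyndonCircuits <-sto w
  open LyndonCircuit
  open ≤-Reasoning

  Ls : List LyndonCircuit
  Ls = lyndonCircuits cs∈

  distinct′ : AllPairs (λ c c′ → ¬ SameCircuit c c′) (map arcs Ls)
  distinct′ = subst (AllPairs _) (sym (map-arcs-lyndonCircuits cs∈)) distinct
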